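{- For every tree-automatic structure $\mathfrak S$ there is an isomorphic unary tree-automatic structure $\mathfrak S'$ whose domain is a subset of $\mathcal T_{\mathsf{bin}}$. Moreover, there is a computable isomorphism from $\mathfrak S$ to $\mathfrak S'$.
   Context: A finite $\Sigma$-labeled binary tree is $(T,\lambda)$ with $T$ a nonempty finite prefix-closed subset of $\{0,1\}^*$ and $\lambda:T\to\Sigma$. A relational structure is tree-automatic (over a finite alphabet $\Sigma$) if its domain is a regular (tree-automaton-recognizable) set of finite $\Sigma$-labeled binary trees and for each relation the set of convolutions of its tuples (overlay of the trees with labels padded by a fresh symbol $\diamond$ where a tree is undefined) is regular. It is unary tree-automatic if $\Sigma$ is a singleton, i.e. its domain consists of unlabeled finite binary trees. $\mathcal T_{\mathsf{bin}}$ is the set of finite unlabeled binary trees $t$ such that for all $u\in t$, $u0\in t\iff u1\in t$. -}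

module Defs where

open import Data.Nat using (ℕ; suc)
open import Data.Fin using (Fin)
open import Data.Bool using (Bool; T)
open import Data.Maybe using (Maybe; just; nothing; fromMaybe)
import Data.Maybe as Maybe
open import Data.Product using (Σ; _×_; _,_; ∃)
open import Data.Unit using (⊤)
open import Data.Vec using (Vec; []; _∷_; replicate)
import Data.Vec as Vec
open import Data.Vec.Relation.Unary.All using (All)
open import Relation.Binary.PropositionalEquality using (_≡_)

-- A nonempty finite prefix-closed T ⊆ {0,1}* with λ : T → Σ is encoded
-- inductively: a node carries its label and optionally its 0-child and
-- its 1-child subtrees.

data Tree (A : Set) : Set where
  node : A → Maybe (Tree A) → Maybe (Tree A) → Tree A

mapTree : {A B : Set} → (A → B) → Tree A → Tree B
mapTreeM : {A B : Set} → (A → B) → Maybe (Tree A) → Maybe (Tree B)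
mapTree f (node a l r) = node (f a) (mapTreeM f l) (mapTreeM f r)
mapTreeM f nothing = nothing
mapTreeM f (just t) = just (mapTree f t)

-- Convolution.  The padding symbol ⋄ is represented by `nothing`.

overlay : {A B : Set} → Maybe (Tree A) → Maybe (Tree B) →
          Maybe (Tree (Maybe A × Maybe B))
overlay nothing nothing = nothing
overlay (just (node a l r)) nothing =
  just (node (just a , nothing) (overlay l nothing) (overlay r nothing))
overlay nothing (just (node b l r)) =
  just (node (nothing , just b) (overlay nothing l) (overlay nothing r))
overlay (just (node a l r)) (just (node b l′ r′)) =
  just (node (just a , just b) (overlay l l′) (overlay r r′))

convM : {A : Set} {k : ℕ} → Vec (Maybe (Tree A)) k → Maybe (Tree (Vec (Maybe A) k))
convM [] = nothing
convM {A} {suc k} (m ∷ ms) = mapTreeM f (overlay m (convM ms))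
  where
    f : Maybe A × Maybe (Vec (Maybe A) k) → Vec (Maybe A) (suc k)
    f (x , y) = x ∷ fromMaybe (replicate k nothing) y

-- convolution of a tuple of trees (undefined, i.e. `nothing`, only for
-- the empty tuple)
conv : {A : Set} {k : ℕ} → Vec (Tree A) k → Maybe (Tree (Vec (Maybe A) k))
conv ts = convM (Vec.map just ts)

-- Nondeterministic (bottom-up) finite tree automata over trees in which
-- a child may be missing (`nothing` = missing child).

record TA (A : Set) : Set where
  field
    states : ℕ
    δ      : Maybe (Fin states) → Maybe (Fin states) → A → Fin states → Bool
    final  : Fin states → Bool

module _ {A : Set} (M : TA A) where
  open TA M

  data Reach : Tree A → Fin states → Set
  data ReachM : Maybe (Tree A) → Maybe (Fin states) → Set

  data Reach where
    step : ∀ {a l r ql qr q} → ReachM l ql → ReachM r qr →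
           T (δ ql qr a q) → Reach (node a l r) q

  data ReachM where
    absent  : ReachM nothing nothing
    present : ∀ {t q} → Reach t q → ReachM (just t) (just q)

  Accepts : Tree A → Set
  Accepts t = Σ (Fin states) λ q → Reach t q × T (final q)

Regular : {A : Set} → (Tree A → Set) → Set
Regular {A} L = Σ (TA A) λ M → (∀ t → L t → Accepts M t) × (∀ t → Accepts M t → L t)

record Signature : Set where
  field
    nrels : ℕ
    arity : Fin nrels → ℕ

record TreeStructure (A : Set) (sig : Signature) : Set₁ where
  open Signature sig
  field
    dom : Tree A → Set
    rel : (i : Fin nrels) → Vec (Tree A) (arity i) → Set
    rel⊆dom : ∀ i ts → rel i ts → All dom ts

ConvSet : {A : Set} {k : ℕ} → (Vec (Tree A) k → Set) → Tree (Vec (Maybe A) k) → Set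
ConvSet R t = ∃ λ ts → R ts × conv ts ≡ just t

TreeAutomatic : {A : Set} {sig : Signature} → TreeStructure A sig → Set
TreeAutomatic {A} {sig} S =
  Regular dom × ((i : Fin (Signature.nrels sig)) → Regular (ConvSet (rel i)))
  where open TreeStructure S

TreeAutomaticOver : (s : ℕ) {sig : Signature} → TreeStructure (Fin s) sig → Set
TreeAutomaticOver s S = TreeAutomatic S

UnaryTreeAutomatic : {sig : Signature} → TreeStructure ⊤ sig → Set
UnaryTreeAutomatic S = TreeAutomatic S

data InTbin : Tree ⊤ → Set where
  leaf  : ∀ {a} → InTbin (node a nothing nothing)
  inner : ∀ {a l r} → InTbin l → InTbin r → InTbin (node a (just l) (just r))

-- Isomorphisms given by a (total, hence computable) function on trees.

record IsIsomorphism {A B : Set} {sig : Signature}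
                     (S : TreeStructure A sig) (S′ : TreeStructure B sig)
                     (f : Tree A → Tree B) : Set where
  open Signature sig
  private
    module S  = TreeStructure S
    module S′ = TreeStructure S′
  field
    maps-dom   : ∀ t → S.dom t → S′.dom (f t)
    injective  : ∀ t u → S.dom t → S.dom u → f t ≡ f u → t ≡ u
    surjective : ∀ u → S′.dom u → ∃ λ t → S.dom t × f t ≡ u
    preserves  : ∀ i ts → All S.dom ts → S.rel i ts → S′.rel i (Vec.map f ts)
    reflects   : ∀ i ts → All S.dom ts → S′.rel i (Vec.map f ts) → S.rel i ts

-- Encode a tree t over Fin s as an unlabelled full binary tree: a node labelled a becomes a node
-- whose left child carries the encodings of the two subtrees (an absent subtree becomes a leaf)
-- and whose right child is a right spine of length a.  Since the subtrees sit at the same place in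
-- every encoded tree, the convolution of the encodings of t₁ … t_k is obtained from the
-- convolution c of t₁ … t_k by a fixed local transformation (encodeConv): every node v of c is
-- replaced by a small gadget labelled by the pattern of present tracks, with the convolution of
-- the unary codes of the labels in v hung on the right.  A bottom-up automaton with finitely many
-- states (leaves, codes of labels, the gadget's inner node, and gadget roots remembering a state
-- of an automaton for c) accepts exactly the images of accepted convolutions, so every relation
-- stays regular; the domain is treated as a unary relation.  The encoding is injective, so it is
-- an isomorphism onto its image.

module Submission where

open import Defs
open import Data.Bool using (Bool; true; false; T; if_then_else_; _∧_)
import Data.Bool.Properties as Bool
open import Data.Empty using (⊥)
open import Data.Fin using (Fin; zero; suc; toℕ; inject₁)
import Data.Fin as Fin
open import Data.Fin.Properties using (1↔⊤; +↔⊎; *↔×; toℕ-injective; toℕ-inject₁; any?)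
open import Data.Maybe using (Maybe; just; nothing; is-nothing; _>>=_)
import Data.Maybe as Maybe
open import Data.Maybe.Properties using (just-injective)
import Data.Maybe.Properties as Maybe
open import Data.Maybe.Relation.Binary.Pointwise using (Pointwise; just; nothing)
open import Data.Maybe.Relation.Unary.All using (just; nothing) renaming (All to AllM)
open import Data.Nat using (ℕ; zero; suc; _+_; _*_)
open import Data.Product using (Σ; _×_; _,_; proj₁; proj₂; ∃; uncurry)
open import Data.Product.Function.NonDependent.Propositional using (_×-↩_)
open import Data.Sum using (_⊎_; inj₁; inj₂)
open import Data.Sum.Function.Propositional using (_⊎-↩_)
open import Data.Unit using (⊤; tt)
open import Data.Vec using (Vec; []; _∷_; replicate; zipWith)
import Data.Vec as Vec
open import Data.Vec.Properties using (map-∘; map-cong; map-id; map-replicate; ∷-injective)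
open import Data.Vec.Relation.Binary.Pointwise.Inductive using ([]; _∷_) renaming (Pointwise to VecPointwise)
import Data.Vec.Relation.Unary.All as All
import Data.Vec.Relation.Unary.All.Properties as All
open import Function using (_∘_; id; const; _⇔_; mk⇔; Injective)
open import Function.Bundles using (_↩_; mk↩; LeftInverse; Equivalence)
open import Function.Consequences.Propositional using (strictlyInverseˡ⇒inverseˡ)
open import Function.Construct.Composition using (_↩-∘_)
open import Function.Construct.Identity using (↩-id)
open import Function.Properties.Inverse using (↔⇒↩)
open import Relation.Binary.Definitions using (DecidableEquality)
open import Relation.Binary.PropositionalEquality
open import Relation.Nullary using (Dec; no; contradiction)
open import Relation.Nullary.Decidable using (⌊_⌋; toWitness; fromWitness; _×-dec_; map′; T?)

-- Finite types

Finite : Set → Set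
Finite A = Σ ℕ λ n → Fin n ↩ A

mk↩ₛ : {A B : Set} (to : A → B) (from : B → A) → (∀ b → to (from b) ≡ b) → A ↩ B
mk↩ₛ to from inv = mk↩ (strictlyInverseˡ⇒inverseˡ to inv)

finite-retract : {A B : Set} → Finite A → A ↩ B → Finite B
finite-retract (n , f) g = n , g ↩-∘ f

finite-⊤ : Finite ⊤
finite-⊤ = 1 , ↔⇒↩ 1↔⊤

finite-Fin : ∀ n → Finite (Fin n)
finite-Fin n = n , ↩-id _

finite-⊎ : {A B : Set} → Finite A → Finite B → Finite (A ⊎ B)
finite-⊎ (m , f) (n , g) = m + n , (f ⊎-↩ g) ↩-∘ ↔⇒↩ +↔⊎

finite-× : {A B : Set} → Finite A → Finite B → Finite (A × B)
finite-× (m , f) (n , g) = m * n , (f ×-↩ g) ↩-∘ ↔⇒↩ *↔×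

finite-Maybe : {A : Set} → Finite A → Finite (Maybe A)
finite-Maybe {A} fin-A = finite-retract (finite-⊎ finite-⊤ fin-A) (mk↩ₛ to from inv)
  where
    to : ⊤ ⊎ A → Maybe A
    to (inj₁ _) = nothing
    to (inj₂ a) = just a
    from : Maybe A → ⊤ ⊎ A
    from nothing  = inj₁ tt
    from (just a) = inj₂ a
    inv : ∀ m → to (from m) ≡ m
    inv nothing  = refl
    inv (just a) = refl

finite-Vec : {A : Set} → Finite A → ∀ k → Finite (Vec A k)
finite-Vec fin-A zero    = finite-retract finite-⊤ (mk↩ₛ (const []) (const tt) λ { [] → refl })
finite-Vec fin-A (suc k) = finite-retract (finite-× fin-A (finite-Vec fin-A k))
  (mk↩ₛ (uncurry _∷_) (λ v → Vec.head v , Vec.tail v) λ { (a ∷ v) → refl })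

finite-≟ : {A : Set} → Finite A → DecidableEquality A
finite-≟ (n , f) a b = map′ from-injective (cong from) (from a Fin.≟ from b)
  where
    open LeftInverse f
    from-injective : from a ≡ from b → a ≡ b
    from-injective e = trans (sym (strictlyInverseˡ a)) (trans (cong to e) (strictlyInverseˡ b))

finite-∃? : {A : Set} {P : A → Set} → Finite A → (∀ a → Dec (P a)) → Dec (∃ P)
finite-∃? {P = P} (n , f) P? =
  map′ (λ (i , p) → to i , p) (λ (a , p) → from a , subst P (sym (strictlyInverseˡ a)) p) (any? (P? ∘ to))
  where open LeftInverse f

-- Regular tree languages

root : {A : Set} → Tree A → A
root (node a _ _) = a

left right : {A : Set} → Tree A → Maybe (Tree A)
left  (node _ l _) = l
right (node _ _ r) = r

data AllNodes {A : Set} (P : A → Set) : Tree A → Set where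
  node : ∀ {a l r} → P a → AllM (AllNodes P) l → AllM (AllNodes P) r → AllNodes P (node a l r)

module FiniteStateAutomaton {A Q : Set} (finite-Q : Finite Q)
  (Step : Maybe Q → Maybe Q → A → Q → Set) (step? : ∀ l r a q → Dec (Step l r a q))
  (Final : Q → Set) (final? : ∀ q → Dec (Final q)) where

  open LeftInverse (proj₂ finite-Q)

  data Run : Tree A → Q → Set where
    step : ∀ {a l r ql qr q} → Pointwise Run l ql → Pointwise Run r qr → Step ql qr a q →
           Run (node a l r) q

  Accepting : Tree A → Set
  Accepting t = ∃ λ q → Run t q × Final q

  automaton : TA A
  automaton = record
    { states = proj₁ finite-Q
    ; δ      = λ l r a q → ⌊ step? (Maybe.map to l) (Maybe.map to r) a (to q) ⌋
    ; final  = λ q → ⌊ final? (to q) ⌋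
    }

  reach⇒run : ∀ {t i} → Reach automaton t i → Run t (to i)
  reachM⇒run : ∀ {m mi} → ReachM automaton m mi → Pointwise Run m (Maybe.map to mi)
  reach⇒run (step l r δ) = step (reachM⇒run l) (reachM⇒run r) (toWitness δ)
  reachM⇒run absent      = nothing
  reachM⇒run (present d) = just (reach⇒run d)

  to∘from : ∀ m → Maybe.map to (Maybe.map from m) ≡ m
  to∘from nothing  = refl
  to∘from (just q) = cong just (strictlyInverseˡ q)

  run⇒reach : ∀ {t q} → Run t q → Reach automaton t (from q)
  runM⇒reach : ∀ {m mq} → Pointwise Run m mq → ReachM automaton m (Maybe.map from mq)
  run⇒reach {node a _ _} {q} (step {ql = ql} {qr} l r s) = step (runM⇒reach l) (runM⇒reach r)
    (fromWitness (subst₂ (λ ql′ qr′ → Step ql′ qr′ a _) (sym (to∘from ql)) (sym (to∘from qr))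
                   (subst (Step ql qr a) (sym (strictlyInverseˡ q)) s)))
  runM⇒reach nothing  = absent
  runM⇒reach (just d) = present (run⇒reach d)

  regular : {L : Tree A → Set} → (∀ t → L t ⇔ Accepting t) → Regular L
  regular L⇔ = automaton
    , (λ t → accepts ∘ Equivalence.to (L⇔ t))
    , λ { t (i , r , f) → Equivalence.from (L⇔ t) (to i , reach⇒run r , toWitness f) }
    where
      accepts : ∀ {t} → Accepting t → Accepts automaton t
      accepts (q , r , f) = from q , run⇒reach r , fromWitness (subst Final (sym (strictlyInverseˡ q)) f)

Regular-cong : {A : Set} {L L′ : Tree A → Set} → (∀ t → L t ⇔ L′ t) → Regular L → Regular L′
Regular-cong L⇔L′ (M , sound , complete) =
  M , (λ t → sound t ∘ Equivalence.from (L⇔L′ t)) , (λ t → Equivalence.to (L⇔L′ t) ∘ complete t)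

mapTree-injective : {A B : Set} {f : A → B} → Injective _≡_ _≡_ f → Injective _≡_ _≡_ (mapTree f)
mapTreeM-injective : {A B : Set} {f : A → B} → Injective _≡_ _≡_ f → Injective _≡_ _≡_ (mapTreeM f)
mapTree-injective f-inj {node a l r} {node a′ l′ r′} e
  with refl ← f-inj (cong root e)
     | refl ← mapTreeM-injective f-inj (cong left e)
     | refl ← mapTreeM-injective f-inj (cong right e) = refl
mapTreeM-injective f-inj {nothing} {nothing} e = refl
mapTreeM-injective f-inj {just t}  {just u}  e = cong just (mapTree-injective f-inj (just-injective e))

module _ {A B : Set} (f : A → B) where

  Regular-preimage : {L : Tree B → Set} → Regular L → Regular (L ∘ mapTree f)
  Regular-preimage (M , sound , complete) =
    M′ , (λ t → reflect-accepts ∘ sound _) , (λ t → complete _ ∘ preserve-accepts)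
    where
      open TA M
      M′ : TA A
      M′ = record { states = states ; δ = λ ql qr a → δ ql qr (f a) ; final = final }

      reflect : ∀ {t q} → Reach M (mapTree f t) q → Reach M′ t q
      reflectM : ∀ {m q} → ReachM M (mapTreeM f m) q → ReachM M′ m q
      reflect {node _ _ _} (step l r δ) = step (reflectM l) (reflectM r) δ
      reflectM {nothing} absent      = absent
      reflectM {just _}  (present d) = present (reflect d)

      preserve : ∀ {t q} → Reach M′ t q → Reach M (mapTree f t) q
      preserveM : ∀ {m q} → ReachM M′ m q → ReachM M (mapTreeM f m) q
      preserve (step l r δ) = step (preserveM l) (preserveM r) δ
      preserveM absent      = absent
      preserveM (present d) = present (preserve d)

      reflect-accepts : ∀ {t} → Accepts M (mapTree f t) → Accepts M′ t
      reflect-accepts (q , d , fin) = q , reflect d , fin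
      preserve-accepts : ∀ {t} → Accepts M′ t → Accepts M (mapTree f t)
      preserve-accepts (q , d , fin) = q , preserve d , fin

  Image : (Tree A → Set) → Tree B → Set
  Image L u = ∃ λ t → L t × mapTree f t ≡ u

  Regular-image : (g : B → Maybe A) → (∀ a → g (f a) ≡ just a) → (∀ {b a} → g b ≡ just a → f a ≡ b) →
                  {L : Tree A → Set} → Regular L → Regular (Image L)
  Regular-image g g∘f f∘g {L} (M , sound , complete) =
    M′ , (λ { _ (t , x , refl) → lift-accepts (sound t x) }) , (λ u → lower-accepts)
    where
      open TA M
      M′ : TA B
      M′ = record { states = states ; δ = λ ql qr b q → Maybe.maybe (λ a → δ ql qr a q) false (g b)
                  ; final = final }

      lift : ∀ {t q} → Reach M t q → Reach M′ (mapTree f t) q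
      liftM : ∀ {m q} → ReachM M m q → ReachM M′ (mapTreeM f m) q
      lift {node a _ _} {q} (step {ql = ql} {qr} l r δ′) =
        step (liftM l) (liftM r) (subst (T ∘ Maybe.maybe (λ a → δ ql qr a q) false) (sym (g∘f a)) δ′)
      liftM absent      = absent
      liftM (present d) = present (lift d)

      lower : ∀ {u q} → Reach M′ u q → ∃ λ t → Reach M t q × mapTree f t ≡ u
      lowerM : ∀ {m q} → ReachM M′ m q → ∃ λ m′ → ReachM M m′ q × mapTreeM f m′ ≡ m
      lower {node b _ _} (step l r δ′) with g b in gb | lowerM l | lowerM r
      ... | just a | tl , dl , refl | tr , dr , refl =
        node a tl tr , step dl dr δ′ , cong (λ b → node b _ _) (f∘g gb)
      lowerM absent = nothing , absent , refl
      lowerM (present d) with lower d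
      ... | t , d′ , refl = just t , present d′ , refl

      lift-accepts : ∀ {t} → Accepts M t → Accepts M′ (mapTree f t)
      lift-accepts (q , d , fin) = q , lift d , fin
      lower-accepts : ∀ {u} → Accepts M′ u → Image L u
      lower-accepts (q , d , fin) with lower d
      ... | t , d′ , refl = t , complete t (q , d′ , fin) , refl

-- Convolutions

isBlank : {A : Set} {k : ℕ} → Vec (Maybe A) k → Bool
isBlank []       = true
isBlank (m ∷ ms) = is-nothing m ∧ isBlank ms

NonBlank : {A : Set} {k : ℕ} → Vec (Maybe A) k → Set
NonBlank v = isBlank v ≡ false

blank⇒replicate : {A : Set} {k : ℕ} (ms : Vec (Maybe A) k) → isBlank ms ≡ true → ms ≡ replicate k nothing
blank⇒replicate []             _ = refl
blank⇒replicate (nothing ∷ ms) b = cong (nothing ∷_) (blank⇒replicate ms b)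

isBlank-map : {A B : Set} {k : ℕ} {f : Maybe A → Maybe B} → (∀ m → is-nothing (f m) ≡ is-nothing m) →
              (ms : Vec (Maybe A) k) → isBlank (Vec.map f ms) ≡ isBlank ms
isBlank-map f-nothing []       = refl
isBlank-map f-nothing (m ∷ ms) = cong₂ _∧_ (f-nothing m) (isBlank-map f-nothing ms)

isBlank-map-maybe : {A B : Set} {k : ℕ} (f : A → B) (ms : Vec (Maybe A) k) →
                    isBlank (Vec.map (Maybe.map f) ms) ≡ isBlank ms
isBlank-map-maybe f = isBlank-map λ { nothing → refl ; (just _) → refl }

map-map : {A B C : Set} {k : ℕ} {f : B → C} {g : A → B} {h : A → C} → (∀ a → f (g a) ≡ h a) →
          (xs : Vec A k) → Vec.map f (Vec.map g xs) ≡ Vec.map h xs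
map-map fg≗h xs = trans (sym (map-∘ _ _ xs)) (map-cong fg≗h xs)

module _ {A : Set} where

  roots : ∀ {k} → Vec (Maybe (Tree A)) k → Vec (Maybe A) k
  roots = Vec.map (Maybe.map root)

  lefts rights : ∀ {k} → Vec (Maybe (Tree A)) k → Vec (Maybe (Tree A)) k
  lefts  = Vec.map (_>>= left)
  rights = Vec.map (_>>= right)

  convM-replicate : ∀ k → convM {A} (replicate k nothing) ≡ nothing
  convM-replicate zero = refl
  convM-replicate (suc k) rewrite convM-replicate k = refl

  convM-blank : ∀ {k} (ms : Vec (Maybe (Tree A)) k) → isBlank ms ≡ true → convM ms ≡ nothing
  convM-blank {k} ms b = subst (λ ms → convM ms ≡ nothing) (sym (blank⇒replicate ms b)) (convM-replicate k)

  convM-nonblank : ∀ {k} (ms : Vec (Maybe (Tree A)) k) → NonBlank ms →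
                   convM ms ≡ just (node (roots ms) (convM (lefts ms)) (convM (rights ms)))
  convM-nonblank (nothing ∷ ms) b rewrite convM-nonblank ms b = refl
  convM-nonblank {suc k} (just (node a l r) ∷ ms) _ with isBlank ms in b
  ... | false rewrite convM-nonblank ms b = refl
  ... | true with refl ← blank⇒replicate ms b
    rewrite map-replicate (Maybe.map (root {A})) nothing k
          | map-replicate (_>>= left {A}) nothing k | map-replicate (_>>= right {A}) nothing k
          | convM-replicate k = refl

  convM-just : ∀ {k} (ms : Vec (Maybe (Tree A)) k) {v cl cr} → convM ms ≡ just (node v cl cr) →
               NonBlank ms × roots ms ≡ v × convM (lefts ms) ≡ cl × convM (rights ms) ≡ cr
  convM-just ms e with isBlank ms in b
  ... | true  with () ← trans (sym (convM-blank ms b)) e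
  ... | false with refl ← trans (sym (convM-nonblank ms b)) e = refl , refl , refl , refl

  convM-nothing : ∀ {k} (ms : Vec (Maybe (Tree A)) k) → convM ms ≡ nothing → isBlank ms ≡ true
  convM-nothing ms e with isBlank ms in b
  ... | true  = refl
  ... | false with () ← trans (sym (convM-nonblank ms b)) e

  convM-allNonBlank : ∀ {k} (ms : Vec (Maybe (Tree A)) k) {c} → convM ms ≡ just c → AllNodes NonBlank c
  convM-allNonBlank ms {node v cl cr} e with convM-just ms e
  ... | b , refl , el , er =
    node (trans (isBlank-map-maybe root ms) b) (subtrees (lefts ms) el) (subtrees (rights ms) er)
    where
      subtrees : ∀ {k} (ms′ : Vec (Maybe (Tree A)) k) {c′} → convM ms′ ≡ c′ → AllM (AllNodes NonBlank) c′
      subtrees ms′ {nothing} _  = nothing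
      subtrees ms′ {just _}  e′ = just (convM-allNonBlank ms′ e′)

single : {A : Set} → A → Vec (Maybe A) 1
single a = just a ∷ []

single-injective : {A : Set} → Injective _≡_ _≡_ (single {A})
single-injective refl = refl

conv-single : {A : Set} (t : Tree A) → conv (t ∷ []) ≡ just (mapTree single t)
convM-single : {A : Set} (m : Maybe (Tree A)) → convM (m ∷ []) ≡ mapTreeM single m
conv-single t = convM-single (just t)
convM-single nothing = refl
convM-single (just (node a l r)) = cong₂ (λ l r → just (node (single a) l r)) (convM-single l) (convM-single r)

Regular-ConvSet-head : {A : Set} {L : Tree A → Set} → Regular L → Regular (ConvSet (L ∘ Vec.head))
Regular-ConvSet-head {A} {L} =
  Regular-cong (λ c → mk⇔ to from) ∘ Regular-image single unsingle (λ _ → refl) single-unsingle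
  where
    unsingle : Vec (Maybe A) 1 → Maybe A
    unsingle (m ∷ []) = m
    single-unsingle : ∀ {b a} → unsingle b ≡ just a → single a ≡ b
    single-unsingle {_ ∷ []} refl = refl
    to : ∀ {c} → Image single L c → ConvSet (L ∘ Vec.head) c
    to (t , x , refl) = t ∷ [] , x , conv-single t
    from : ∀ {c} → ConvSet (L ∘ Vec.head) c → Image single L c
    from (t ∷ [] , x , e) = t , x , just-injective (trans (sym (conv-single t)) e)

-- The encoding

tip : Tree ⊤
tip = node tt nothing nothing

unaryCode : ℕ → Tree ⊤
unaryCode zero    = tip
unaryCode (suc n) = node tt (just tip) (just (unaryCode n))

unaryCode-injective : Injective _≡_ _≡_ unaryCode
unaryCode-injective {zero}  {zero}  e = refl
unaryCode-injective {suc m} {suc n} e = cong suc (unaryCode-injective (just-injective (cong right e)))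

unaryCode-Tbin : ∀ n → InTbin (unaryCode n)
unaryCode-Tbin zero    = leaf
unaryCode-Tbin (suc n) = inner leaf (unaryCode-Tbin n)

module _ {s : ℕ} where

  encode : Tree (Fin s) → Tree ⊤
  encodeM : Maybe (Tree (Fin s)) → Tree ⊤
  encode (node a l r) = node tt (just (node tt (just (encodeM l)) (just (encodeM r)))) (just (unaryCode (toℕ a)))
  encodeM nothing  = tip
  encodeM (just t) = encode t

  encode-injective : Injective _≡_ _≡_ encode
  encodeM-injective : Injective _≡_ _≡_ encodeM
  encode-injective {node a l r} {node a′ l′ r′} e
    with refl ← toℕ-injective (unaryCode-injective (just-injective (cong right e)))
       | refl ← encodeM-injective {l} {l′} (just-injective (cong (λ t → left t >>= left) e))
       | refl ← encodeM-injective {r} {r′} (just-injective (cong (λ t → left t >>= right) e)) = refl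
  encodeM-injective {nothing} {nothing} e = refl
  encodeM-injective {just t}  {just u}  e = cong just (encode-injective e)
  encodeM-injective {nothing} {just (node _ _ _)} ()
  encodeM-injective {just (node _ _ _)} {nothing} ()

  encode-Tbin : ∀ t → InTbin (encode t)
  encodeM-Tbin : ∀ m → InTbin (encodeM m)
  encode-Tbin (node a l r) = inner (inner (encodeM-Tbin l) (encodeM-Tbin r)) (unaryCode-Tbin (toℕ a))
  encodeM-Tbin nothing  = leaf
  encodeM-Tbin (just t) = encode-Tbin t

-- Convolutions of encodings

Presence : ℕ → Set
Presence k = Vec (Maybe ⊤) k

presence : {A : Set} {k : ℕ} → Vec (Maybe A) k → Presence k
presence = Vec.map (Maybe.map (const tt))

allPresent : ∀ k → Presence k
allPresent k = replicate k (just tt)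

holeConv : ∀ {k} → Presence k → Maybe (Tree (Presence k))
holeConv x = if isBlank x then nothing else just (node x nothing nothing)

holeConv-nonblank : ∀ {k} {x : Presence k} → NonBlank x → holeConv x ≡ just (node x nothing nothing)
holeConv-nonblank b rewrite b = refl

tips : ∀ {k} → Presence k → Vec (Maybe (Tree ⊤)) k
tips = Vec.map (Maybe.map (const tip))

roots-tips : ∀ {k} (x : Presence k) → roots (tips x) ≡ x
roots-tips x = trans (map-map {h = id} (λ { nothing → refl ; (just _) → refl }) x) (map-id x)

subtrees-tips : ∀ {k} (f : Tree ⊤ → Maybe (Tree ⊤)) → f tip ≡ nothing →
                (x : Presence k) → Vec.map (_>>= f) (tips x) ≡ replicate k nothing
subtrees-tips f f-tip []            = refl
subtrees-tips f f-tip (nothing ∷ x) = cong (nothing ∷_) (subtrees-tips f f-tip x)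
subtrees-tips f f-tip (just _ ∷ x)  = cong₂ _∷_ f-tip (subtrees-tips f f-tip x)

convM-tips : ∀ {k} (x : Presence k) → convM (tips x) ≡ holeConv x
convM-tips {k} x with isBlank x in b
... | true  = convM-blank (tips x) (trans (isBlank-map-maybe (const tip) x) b)
... | false rewrite convM-nonblank (tips x) (trans (isBlank-map-maybe (const tip) x) b)
                  | roots-tips x | subtrees-tips left refl x | subtrees-tips right refl x
                  | convM-replicate {⊤} k = refl

module _ {s : ℕ} where

  Label : ℕ → Set
  Label k = Vec (Maybe (Fin s)) k

  codes : ∀ {k} → Label k → Vec (Maybe (Tree ⊤)) k
  codes = Vec.map (Maybe.map (unaryCode ∘ toℕ))

  codeConv : ∀ {k} → Label k → Maybe (Tree (Presence k))
  codeConv w = convM (codes w)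

  predFin : Fin s → Maybe (Fin s)
  predFin zero    = nothing
  predFin (suc i) = just (inject₁ i)

  preds : ∀ {k} → Label k → Label k
  preds = Vec.map (_>>= predFin)

  roots-codes : ∀ {k} (w : Label k) → roots (codes w) ≡ presence w
  roots-codes = map-map λ { nothing → refl ; (just _) → refl }

  lefts-codes : ∀ {k} (w : Label k) → lefts (codes w) ≡ tips (presence (preds w))
  lefts-codes []                 = refl
  lefts-codes (nothing ∷ w)      = cong (nothing ∷_) (lefts-codes w)
  lefts-codes (just zero ∷ w)    = cong (nothing ∷_) (lefts-codes w)
  lefts-codes (just (suc i) ∷ w) = cong (just tip ∷_) (lefts-codes w)

  rights-codes : ∀ {k} (w : Label k) → rights (codes w) ≡ codes (preds w)
  rights-codes []                 = refl
  rights-codes (nothing ∷ w)      = cong (nothing ∷_) (rights-codes w)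
  rights-codes (just zero ∷ w)    = cong (nothing ∷_) (rights-codes w)
  rights-codes (just (suc i) ∷ w) =
    cong₂ _∷_ (cong (just ∘ unaryCode) (sym (toℕ-inject₁ i))) (rights-codes w)

  codeConv-node : ∀ {k} (w : Label k) → NonBlank w →
                  codeConv w ≡ just (node (presence w) (holeConv (presence (preds w))) (codeConv (preds w)))
  codeConv-node w b
    rewrite convM-nonblank (codes w) (trans (isBlank-map-maybe (unaryCode ∘ toℕ) w) b)
          | roots-codes w | lefts-codes w | convM-tips (presence (preds w)) | rights-codes w = refl

  -- x is the presence pattern of the encoded node itself.  It is inherited from the parent: a
  -- track in which the parent is present but the subtree is absent has a leaf here.
  encodeConv : ∀ {k} → Presence k → Tree (Label k) → Tree (Presence k)
  encodeConvM : ∀ {k} → Presence k → Maybe (Tree (Label k)) → Maybe (Tree (Presence k))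
  encodeConv x (node v l r) =
    node x (just (node (presence v) (encodeConvM (presence v) l) (encodeConvM (presence v) r))) (codeConv v)
  encodeConvM x nothing  = holeConv x
  encodeConvM x (just c) = just (encodeConv x c)

  encodeHole : Maybe ⊤ → Maybe (Tree (Fin s)) → Maybe (Tree ⊤)
  encodeHole (just _) m = just (encodeM m)
  encodeHole nothing  m = Maybe.map encode m

  encodeHoles : ∀ {k} → Presence k → Vec (Maybe (Tree (Fin s))) k → Vec (Maybe (Tree ⊤)) k
  encodeHoles = zipWith encodeHole

  encodeBranch : Tree (Fin s) → Tree ⊤
  encodeBranch (node _ l r) = node tt (just (encodeM l)) (just (encodeM r))

  branches : ∀ {k} → Vec (Maybe (Tree (Fin s))) k → Vec (Maybe (Tree ⊤)) k
  branches = Vec.map (Maybe.map encodeBranch)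

  _≽_ : Maybe ⊤ → Maybe (Tree (Fin s)) → Set
  x ≽ nothing = ⊤
  x ≽ just _  = x ≡ just tt

  Covers : ∀ {k} → Presence k → Vec (Maybe (Tree (Fin s))) k → Set
  Covers = VecPointwise _≽_

  covers-nonBlank : ∀ {k} {x : Presence k} {ms} → Covers x ms → NonBlank ms → NonBlank x
  covers-nonBlank {x = just _ ∷ _}                (_ ∷ c) b = refl
  covers-nonBlank {x = nothing ∷ _} {nothing ∷ _} (_ ∷ c) b = covers-nonBlank c b

  covers-subtrees : ∀ {k} (f : Tree (Fin s) → Maybe (Tree (Fin s))) (ms : Vec (Maybe (Tree (Fin s))) k) →
                    Covers (presence (roots ms)) (Vec.map (_>>= f) ms)
  covers-subtrees f []             = []
  covers-subtrees f (nothing ∷ ms) = tt ∷ covers-subtrees f ms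
  covers-subtrees f (just t ∷ ms) with f t
  ... | nothing = tt   ∷ covers-subtrees f ms
  ... | just _  = refl ∷ covers-subtrees f ms

  covers-allPresent : ∀ {k} (ts : Vec (Tree (Fin s)) k) → Covers (allPresent k) (Vec.map just ts)
  covers-allPresent []       = []
  covers-allPresent (t ∷ ts) = refl ∷ covers-allPresent ts

  isBlank-encodeHoles : ∀ {k} {x : Presence k} {ms} → Covers x ms → isBlank (encodeHoles x ms) ≡ isBlank x
  isBlank-encodeHoles [] = refl
  isBlank-encodeHoles {x = just _ ∷ _}                (_ ∷ c) = refl
  isBlank-encodeHoles {x = nothing ∷ _} {nothing ∷ _} (_ ∷ c) = isBlank-encodeHoles c

  roots-encodeHoles : ∀ {k} {x : Presence k} {ms} → Covers x ms → roots (encodeHoles x ms) ≡ x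
  roots-encodeHoles [] = refl
  roots-encodeHoles {x = just _ ∷ _}                (_ ∷ c) = cong (just tt ∷_) (roots-encodeHoles c)
  roots-encodeHoles {x = nothing ∷ _} {nothing ∷ _} (_ ∷ c) = cong (nothing ∷_) (roots-encodeHoles c)

  lefts-encodeHoles : ∀ {k} (x : Presence k) ms → lefts (encodeHoles x ms) ≡ branches ms
  lefts-encodeHoles []            []                        = refl
  lefts-encodeHoles (just _ ∷ x)  (nothing ∷ ms)            = cong (nothing ∷_) (lefts-encodeHoles x ms)
  lefts-encodeHoles (nothing ∷ x) (nothing ∷ ms)            = cong (nothing ∷_) (lefts-encodeHoles x ms)
  lefts-encodeHoles (just _ ∷ x)  (just (node _ _ _) ∷ ms) = cong (_ ∷_) (lefts-encodeHoles x ms)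
  lefts-encodeHoles (nothing ∷ x) (just (node _ _ _) ∷ ms) = cong (_ ∷_) (lefts-encodeHoles x ms)

  rights-encodeHoles : ∀ {k} (x : Presence k) ms → rights (encodeHoles x ms) ≡ codes (roots ms)
  rights-encodeHoles []            []                        = refl
  rights-encodeHoles (just _ ∷ x)  (nothing ∷ ms)            = cong (nothing ∷_) (rights-encodeHoles x ms)
  rights-encodeHoles (nothing ∷ x) (nothing ∷ ms)            = cong (nothing ∷_) (rights-encodeHoles x ms)
  rights-encodeHoles (just _ ∷ x)  (just (node _ _ _) ∷ ms) = cong (_ ∷_) (rights-encodeHoles x ms)
  rights-encodeHoles (nothing ∷ x) (just (node _ _ _) ∷ ms) = cong (_ ∷_) (rights-encodeHoles x ms)

  encodeHoles-blank : ∀ {k} (x : Presence k) → encodeHoles x (replicate k nothing) ≡ tips x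
  encodeHoles-blank []            = refl
  encodeHoles-blank (just _ ∷ x)  = cong (just tip ∷_) (encodeHoles-blank x)
  encodeHoles-blank (nothing ∷ x) = cong (nothing ∷_) (encodeHoles-blank x)

  encodeHoles-allPresent : ∀ {k} (ts : Vec (Tree (Fin s)) k) →
                           encodeHoles (allPresent k) (Vec.map just ts) ≡ Vec.map just (Vec.map encode ts)
  encodeHoles-allPresent []       = refl
  encodeHoles-allPresent (t ∷ ts) = cong (_ ∷_) (encodeHoles-allPresent ts)

  roots-branches : ∀ {k} (ms : Vec (Maybe (Tree (Fin s))) k) → roots (branches ms) ≡ presence (roots ms)
  roots-branches ms = trans (map-map {h = Maybe.map (const tt)} (λ { nothing → refl ; (just _) → refl }) ms)
                            (sym (map-map (λ { nothing → refl ; (just _) → refl }) ms))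

  lefts-branches : ∀ {k} (ms : Vec (Maybe (Tree (Fin s))) k) →
                   lefts (branches ms) ≡ encodeHoles (presence (roots ms)) (lefts ms)
  lefts-branches []                       = refl
  lefts-branches (nothing ∷ ms)           = cong (nothing ∷_) (lefts-branches ms)
  lefts-branches (just (node _ _ _) ∷ ms) = cong (_ ∷_) (lefts-branches ms)

  rights-branches : ∀ {k} (ms : Vec (Maybe (Tree (Fin s))) k) →
                    rights (branches ms) ≡ encodeHoles (presence (roots ms)) (rights ms)
  rights-branches []                       = refl
  rights-branches (nothing ∷ ms)           = cong (nothing ∷_) (rights-branches ms)
  rights-branches (just (node _ _ _) ∷ ms) = cong (_ ∷_) (rights-branches ms)

  convM-encodeHoles : ∀ {k} (x : Presence k) ms → Covers x ms →
                      ∀ {c} → convM ms ≡ c → convM (encodeHoles x ms) ≡ encodeConvM x c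
  convM-branches : ∀ {k} (ms : Vec (Maybe (Tree (Fin s))) k) → NonBlank ms →
                   ∀ {cl cr} → convM (lefts ms) ≡ cl → convM (rights ms) ≡ cr →
                   convM (branches ms) ≡
                     just (node (presence (roots ms)) (encodeConvM (presence (roots ms)) cl)
                                                      (encodeConvM (presence (roots ms)) cr))

  convM-encodeHoles {k} x ms _ {nothing} e = begin
    convM (encodeHoles x ms)
      ≡⟨ cong (convM ∘ encodeHoles x) (blank⇒replicate ms (convM-nothing ms e)) ⟩
    convM (encodeHoles x (replicate k nothing)) ≡⟨ cong convM (encodeHoles-blank x) ⟩
    convM (tips x)                              ≡⟨ convM-tips x ⟩
    holeConv x                                  ∎
    where open ≡-Reasoning
  convM-encodeHoles x ms cov {just (node _ _ _)} e with convM-just ms e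
  ... | b , refl , el , er
    rewrite convM-nonblank (encodeHoles x ms) (trans (isBlank-encodeHoles cov) (covers-nonBlank cov b))
          | roots-encodeHoles cov | lefts-encodeHoles x ms | rights-encodeHoles x ms
          | convM-branches ms b el er = refl

  convM-branches ms b el er
    rewrite convM-nonblank (branches ms) (trans (isBlank-map-maybe encodeBranch ms) b)
          | roots-branches ms | lefts-branches ms | rights-branches ms
          | convM-encodeHoles _ (lefts ms) (covers-subtrees left ms) el
          | convM-encodeHoles _ (rights ms) (covers-subtrees right ms) er = refl

  conv-map-encode : ∀ {k} (ts : Vec (Tree (Fin s)) k) →
                    conv (Vec.map encode ts) ≡ Maybe.map (encodeConv (allPresent k)) (conv ts)
  conv-map-encode [] = refl
  conv-map-encode (t ∷ ts) = begin
    conv (Vec.map encode (t ∷ ts))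
      ≡⟨ cong convM (sym (encodeHoles-allPresent (t ∷ ts))) ⟩
    convM (encodeHoles (allPresent _) (Vec.map just (t ∷ ts)))
      ≡⟨ convM-encodeHoles _ _ (covers-allPresent (t ∷ ts)) refl ⟩
    encodeConvM (allPresent _) (conv (t ∷ ts))
      ≡⟨ encodeConvM-just (convM-nonblank (Vec.map just (t ∷ ts)) refl) ⟩
    Maybe.map (encodeConv (allPresent _)) (conv (t ∷ ts)) ∎
    where
      open ≡-Reasoning
      encodeConvM-just : ∀ {x : Presence _} {m c} → m ≡ just c → encodeConvM x m ≡ Maybe.map (encodeConv x) m
      encodeConvM-just refl = refl

-- An automaton for encoded convolutions

module EncodedConvolutionAutomaton {s k : ℕ} (M : TA (Label {s} k)) where
  open TA M

  data State : Set where
    hole    : Presence k → State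
    label   : Label {s} k → State
    branch  : Presence k → Maybe (Fin states) → Maybe (Fin states) → State
    encoded : Presence k → Fin states → State

  Parse : Tree (Presence k) → State → Set
  Parse u (hole x)         = NonBlank x × node x nothing nothing ≡ u
  Parse u (label w)        = codeConv w ≡ just u
  Parse u (branch y ml mr) = ∃ λ cl → ∃ λ cr → ReachM M cl ml × ReachM M cr mr ×
                             node y (encodeConvM y cl) (encodeConvM y cr) ≡ u
  Parse u (encoded x q)    = ∃ λ c → Reach M c q × encodeConv x c ≡ u

  finite-Presence : Finite (Presence k)
  finite-Presence = finite-Vec (finite-Maybe finite-⊤) k

  finite-Label : Finite (Label {s} k)
  finite-Label = finite-Vec (finite-Maybe (finite-Fin s)) k

  finite-MaybeFin : Finite (Maybe (Fin states))
  finite-MaybeFin = finite-Maybe (finite-Fin states)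

  finite-State : Finite State
  finite-State = finite-retract
    (finite-⊎ finite-Presence (finite-⊎ finite-Label
      (finite-⊎ (finite-× finite-Presence (finite-× finite-MaybeFin finite-MaybeFin))
                (finite-× finite-Presence (finite-Fin states)))))
    (mk↩ₛ to from λ { (hole _) → refl ; (label _) → refl ; (branch _ _ _) → refl ; (encoded _ _) → refl })
    where
      to : _ → State
      to (inj₁ x)                           = hole x
      to (inj₂ (inj₁ w))                    = label w
      to (inj₂ (inj₂ (inj₁ (y , ml , mr)))) = branch y ml mr
      to (inj₂ (inj₂ (inj₂ (x , q))))       = encoded x q
      from : State → _
      from (hole x)         = inj₁ x
      from (label w)        = inj₂ (inj₁ w)
      from (branch y ml mr) = inj₂ (inj₂ (inj₁ (y , ml , mr)))
      from (encoded x q)    = inj₂ (inj₂ (inj₂ (x , q)))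

  _≟ᴾ_ : DecidableEquality (Presence k)
  _≟ᴾ_ = finite-≟ finite-Presence

  _≟ˢ_ : DecidableEquality (Maybe State)
  _≟ˢ_ = Maybe.≡-dec (finite-≟ finite-State)

  childState : Presence k → Maybe (Fin states) → State
  childState y nothing  = hole y
  childState y (just q) = encoded y q

  holeState : Presence k → Maybe State
  holeState x = if isBlank x then nothing else just (hole x)

  labelState : Label k → Maybe State
  labelState w = if isBlank w then nothing else just (label w)

  Step : Maybe State → Maybe State → Presence k → State → Set
  Step l r x (hole y)         = y ≡ x × NonBlank x × l ≡ nothing × r ≡ nothing
  Step l r x (label w)        = presence w ≡ x × NonBlank w ×
                                l ≡ holeState (presence (preds w)) × r ≡ labelState (preds w)
  Step l r x (branch y ml mr) = y ≡ x × l ≡ just (childState x ml) × r ≡ just (childState x mr)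
  Step l r x (encoded y q)    = y ≡ x × ∃ λ ((w , ml , mr) : Label k × Maybe (Fin states) × Maybe (Fin states)) →
                                l ≡ just (branch (presence w) ml mr) × r ≡ just (label w) × T (δ ml mr w q)

  step? : ∀ l r x q → Dec (Step l r x q)
  step? l r x (hole y) = y ≟ᴾ x ×-dec isBlank x Bool.≟ false ×-dec l ≟ˢ nothing ×-dec r ≟ˢ nothing
  step? l r x (label w) = presence w ≟ᴾ x ×-dec isBlank w Bool.≟ false ×-dec
                          l ≟ˢ holeState (presence (preds w)) ×-dec r ≟ˢ labelState (preds w)
  step? l r x (branch y ml mr) = y ≟ᴾ x ×-dec l ≟ˢ just (childState x ml) ×-dec r ≟ˢ just (childState x mr)
  step? l r x (encoded y q) =
    y ≟ᴾ x ×-dec finite-∃? (finite-× finite-Label (finite-× finite-MaybeFin finite-MaybeFin)) λ (w , ml , mr) →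
      l ≟ˢ just (branch (presence w) ml mr) ×-dec r ≟ˢ just (label w) ×-dec T? (δ ml mr w q)

  Final : State → Set
  Final (encoded x q) = x ≡ allPresent k × T (final q)
  Final _             = ⊥

  final? : ∀ q → Dec (Final q)
  final? (hole _)       = no λ ()
  final? (label _)      = no λ ()
  final? (branch _ _ _) = no λ ()
  final? (encoded x q)  = x ≟ᴾ allPresent k ×-dec T? (final q)

  open FiniteStateAutomaton finite-State Step step? Final final? public

  parsed-hole : ∀ x {m} → Pointwise Parse m (holeState x) → holeConv x ≡ m
  parsed-hole x p with isBlank x
  parsed-hole x nothing           | true  = refl
  parsed-hole x (just (_ , refl)) | false = refl

  parsed-label : ∀ w {m} → Pointwise Parse m (labelState w) → codeConv w ≡ m
  parsed-label w p with isBlank w in b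
  parsed-label w nothing  | true  = convM-blank (codes w) (trans (isBlank-map-maybe _ w) b)
  parsed-label w (just p) | false = p

  parsed-child : ∀ y mq {u} → Parse u (childState y mq) → ∃ λ c → ReachM M c mq × encodeConvM y c ≡ just u
  parsed-child y nothing  (b , refl)  = nothing , absent , holeConv-nonblank b
  parsed-child y (just q) (c , d , e) = just c , present d , cong just e

  parse-step : ∀ q {x l r ql qr} → Step ql qr x q → Pointwise Parse l ql → Pointwise Parse r qr →
               Parse (node x l r) q
  parse-step (hole x) (refl , b , refl , refl) nothing nothing = b , refl
  parse-step (label w) (refl , b , refl , refl) pl pr =
    trans (codeConv-node w b) (cong₂ (λ l r → just (node _ l r)) (parsed-hole _ pl) (parsed-label _ pr))
  parse-step (branch y ml mr) (refl , refl , refl) (just pl) (just pr)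
    with parsed-child y ml pl | parsed-child y mr pr
  ... | cl , dl , el | cr , dr , er = cl , cr , dl , dr , cong₂ (node y) el er
  parse-step (encoded y q) (refl , (w , ml , mr) , refl , refl , δ′) (just (cl , cr , dl , dr , e₁)) (just e₂) =
    node w cl cr , step dl dr δ′ , cong₂ (λ b c → node y (just b) c) e₁ e₂

  parse : ∀ {u q} → Run u q → Parse u q
  parseM : ∀ {m mq} → Pointwise Run m mq → Pointwise Parse m mq
  parse (step l r st) = parse-step _ st (parseM l) (parseM r)
  parseM nothing  = nothing
  parseM (just d) = just (parse d)

  -- No `with` on goals mentioning Run below: with-abstraction normalises the goal, which unfolds
  -- the finiteness proof among Run's module parameters and makes type checking blow up.
  hole-run : ∀ x → Pointwise Run (holeConv x) (holeState x)
  hole-run x = by-blankness (isBlank x) refl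
    where
      by-blankness : ∀ b → isBlank x ≡ b →
                     Pointwise Run (if b then nothing else just (node x nothing nothing))
                                   (if b then nothing else just (hole x))
      by-blankness true  _  = nothing
      by-blankness false nb = just (step nothing nothing (refl , nb , refl , refl))

  label-run : ∀ w {m} → codeConv w ≡ m → Pointwise Run m (labelState w)
  label-run w = by-blankness (isBlank w) refl
    where
      by-blankness : ∀ b {m} → isBlank w ≡ b → codeConv w ≡ m →
                     Pointwise Run m (if b then nothing else just (label w))
      by-blankness true b e = subst (λ m → Pointwise Run m nothing)
        (trans (sym (convM-blank (codes w) (trans (isBlank-map-maybe _ w) b))) e) nothing
      by-blankness false {nothing} b e = contradiction (trans (sym e) (codeConv-node w b)) λ ()
      by-blankness false {just (node x l r)} b e =
        just (step (subst (λ l → Pointwise Run l _) (sym (cong left e′)) (hole-run _))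
                   (label-run (preds w) (sym (cong right e′)))
                   (sym (cong root e′) , b , refl , refl))
        where
          e′ : node x l r ≡ node (presence w) (holeConv (presence (preds w))) (codeConv (preds w))
          e′ = just-injective (trans (sym e) (codeConv-node w b))

  encode-run : ∀ {x c q} → AllNodes NonBlank c → Reach M c q → Run (encodeConv x c) (encoded x q)
  encodeM-run : ∀ {y c mq} → NonBlank y → AllM (AllNodes NonBlank) c → ReachM M c mq →
                Pointwise Run (encodeConvM y c) (just (childState y mq))
  encode-run {c = node v _ _} (node b al ar) (step {ql = ml} {qr = mr} dl dr δ′) =
    step (just (step (encodeM-run b′ al dl) (encodeM-run b′ ar dr) (refl , refl , refl)))
         (subst (Pointwise Run (codeConv v)) labelState-v (label-run v refl))
         (refl , (v , ml , mr) , refl , refl , δ′)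
    where
      b′ : NonBlank (presence v)
      b′ = trans (isBlank-map-maybe _ v) b
      labelState-v : labelState v ≡ just (label v)
      labelState-v rewrite b = refl
  encodeM-run {y} b nothing absent =
    subst (λ m → Pointwise Run m (just (hole y))) (sym (holeConv-nonblank b))
          (just (step nothing nothing (refl , b , refl , refl)))
  encodeM-run b (just a) (present d) = just (encode-run a d)

Regular-encodeConv : ∀ {s k} {L : Tree (Label {s} k) → Set} → Regular L → (∀ c → L c → AllNodes NonBlank c) →
                     Regular (λ u → ∃ λ c → L c × encodeConv (allPresent k) c ≡ u)
Regular-encodeConv {k = k} {L} (M , sound , complete) nonBlank = regular λ u → mk⇔ accept reject
  where
    open EncodedConvolutionAutomaton M
    accept : ∀ {u} → (∃ λ c → L c × encodeConv (allPresent k) c ≡ u) → Accepting u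
    accept (c , x , refl) = let (q , d , f) = sound c x in
      encoded (allPresent k) q , encode-run (nonBlank c x) d , refl , f
    reject : ∀ {u} → Accepting u → ∃ λ c → L c × encodeConv (allPresent k) c ≡ u
    reject (encoded x q , run , refl , f) = let (c , d , e) = parse run in c , complete c (q , d , f) , e

-- The encoded structure

Vec-map-injective : {A B : Set} {k : ℕ} {f : A → B} →
                    Injective _≡_ _≡_ f → Injective _≡_ _≡_ (Vec.map {n = k} f)
Vec-map-injective f-inj {[]}     {[]}     e = refl
Vec-map-injective f-inj {x ∷ xs} {y ∷ ys} e =
  cong₂ _∷_ (f-inj (proj₁ (∷-injective e))) (Vec-map-injective f-inj (proj₂ (∷-injective e)))

module _ {s : ℕ} where

  EncodedSet : (Tree (Fin s) → Set) → Tree ⊤ → Set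
  EncodedSet D u = ∃ λ t → D t × encode t ≡ u

  EncodedRel : ∀ {k} → (Vec (Tree (Fin s)) k → Set) → Vec (Tree ⊤) k → Set
  EncodedRel R us = ∃ λ ts → R ts × Vec.map encode ts ≡ us

  Regular-EncodedRel : ∀ {k} {R : Vec (Tree (Fin s)) k → Set} →
                       Regular (ConvSet R) → Regular (ConvSet (EncodedRel R))
  Regular-EncodedRel {k} {R} reg =
    Regular-cong (λ u → mk⇔ to from)
      (Regular-encodeConv reg λ { c (ts , _ , e) → convM-allNonBlank (Vec.map just ts) e })
    where
      map-just⁻ : ∀ {A B : Set} {f : A → B} m {b} → Maybe.map f m ≡ just b → ∃ λ a → m ≡ just a × f a ≡ b
      map-just⁻ (just a) e = a , refl , just-injective e
      to : ∀ {u} → (∃ λ c → ConvSet R c × encodeConv (allPresent k) c ≡ u) → ConvSet (EncodedRel R) u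
      to (c , (ts , x , e) , refl) =
        Vec.map encode ts , (ts , x , refl) , trans (conv-map-encode ts) (cong (Maybe.map _) e)
      from : ∀ {u} → ConvSet (EncodedRel R) u → ∃ λ c → ConvSet R c × encodeConv (allPresent k) c ≡ u
      from (_ , (ts , x , refl) , e) =
        let (c , e′ , e″) = map-just⁻ (conv ts) (trans (sym (conv-map-encode ts)) e) in c , (ts , x , e′) , e″

  Regular-EncodedSet : {D : Tree (Fin s) → Set} → Regular D → Regular (EncodedSet D)
  Regular-EncodedSet {D} =
    Regular-cong (λ u → mk⇔ to from) ∘ Regular-preimage single ∘ Regular-EncodedRel ∘ Regular-ConvSet-head
    where
      to : ∀ {u} → ConvSet (EncodedRel (D ∘ Vec.head)) (mapTree single u) → EncodedSet D u
      to (_ , (t ∷ [] , x , refl) , e) =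
        t , x , mapTree-injective single-injective (just-injective (trans (sym (conv-single (encode t))) e))
      from : ∀ {u} → EncodedSet D u → ConvSet (EncodedRel (D ∘ Vec.head)) (mapTree single u)
      from (t , x , refl) = encode t ∷ [] , (t ∷ [] , x , refl) , conv-single (encode t)

  module _ {sig : Signature} (S : TreeStructure (Fin s) sig) where
    open TreeStructure S

    encodedStructure : TreeStructure ⊤ sig
    encodedStructure = record
      { dom     = EncodedSet dom
      ; rel     = λ i → EncodedRel (rel i)
      ; rel⊆dom = λ { i _ (ts , x , refl) → All.map⁺ (All.map (λ d → _ , d , refl) (rel⊆dom i ts x)) }
      }

    encodedStructure-automatic : TreeAutomatic S → UnaryTreeAutomatic encodedStructure
    encodedStructure-automatic (dom-regular , rel-regular) =
      Regular-EncodedSet dom-regular , λ i → Regular-EncodedRel (rel-regular i)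

    encode-isomorphism : IsIsomorphism S encodedStructure encode
    encode-isomorphism = record
      { maps-dom   = λ t d → t , d , refl
      ; injective  = λ _ _ _ _ → encode-injective
      ; surjective = λ _ d → d
      ; preserves  = λ i ts _ x → ts , x , refl
      ; reflects   = λ { i ts _ (ts′ , x , e) → subst (rel i) (Vec-map-injective encode-injective e) x }
      }

lemma2p16 : (s : ℕ) (sig : Signature) (S : TreeStructure (Fin s) sig) →
    TreeAutomaticOver s S →
    Σ (TreeStructure ⊤ sig) λ S′ →
      UnaryTreeAutomatic S′ ×
      (∀ u → TreeStructure.dom S′ u → InTbin u) ×
      Σ (Tree (Fin s) → Tree ⊤) λ f → IsIsomorphism S S′ f
lemma2p16 s sig S automatic =
  encodedStructure S , encodedStructure-automatic S automatic ,
  (λ { _ (t , _ , refl) → encode-Tbin t }) , encode , encode-isomorphism S
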